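{- Let $B=(b_{i,j})$ be an $n\times n$ alternating sign matrix. Then for every integer $a$, $$\#\{i\in\{1,\dots,n\}:\ \mathcal C(B)_{i,i+a}=a_1\}=\#\{i\in\{1,\dots,n\}:\ \mathcal C(B)_{i,i+a}=a_2\},$$ $$\#\{i\in\{1,\dots,n\}:\ \mathcal C(B)_{i,a-i}=b_1\}=\#\{i\in\{1,\dots,n\}:\ \mathcal C(B)_{i,a-i}=b_2\},$$ where positions outside $\{1,\dots,n\}^2$ are not counted. That is, along each parallel to the diagonal there are as many $a_1$ as $a_2$ vertices, and along each parallel to the anti-diagonal as many $b_1$ as $b_2$ vertices.
   Context: An alternating sign matrix (ASM) is a square matrix with entries in $\{0,1,-1\}$ such that in every row and column the nonzero entries alternate in sign, starting and ending with $1$. The six-vertex type $\mathcal C(B)_{i,j}\in\{a_1,a_2,b_1,b_2,c_1,c_2\}$ (standard bijection ASM $\leftrightarrow$ six-vertex configurations with domain wall boundary conditions) is: $c_1$ if $b_{i,j}=1$; $c_2$ if $b_{i,j}=-1$; if $b_{i,j}=0$, with $r=\sum_{k\le j}b_{i,k}$, $s=\sum_{k\le i}b_{k,j}$ (both in $\{0,1\}$): $a_1$ if $(r,s)=(0,0)$, $b_1$ if $(r,s)=(0,1)$, $b_2$ if $(r,s)=(1,0)$, $a_2$ if $(r,s)=(1,1)$. -}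

module Defs where

open import Data.Nat using (ℕ; zero; suc; _<?_)
open import Data.Integer using (ℤ; +_; -[1+_]; _+_; -_)
open import Data.Fin using (Fin; toℕ; fromℕ<; _≤_)
open import Data.Fin.Properties using (_≤?_)
open import Data.List using (List; []; _∷_; map; filter; length; foldr)
open import Data.List.Base using (allFin)
open import Data.Bool using (Bool; true; false; if_then_else_)
open import Data.Maybe using (Maybe; just; nothing)
open import Relation.Nullary using (yes; no; ¬_)
open import Relation.Binary.PropositionalEquality using (_≡_)

-- n × n integer matrices, 0-based indices (row i, column j)
Matrix : ℕ → Set
Matrix n = Fin n → Fin n → ℤ

nonzeros : List ℤ → List ℤ
nonzeros [] = []
nonzeros (+ zero ∷ xs) = nonzeros xs
nonzeros (x ∷ xs) = x ∷ nonzeros xs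

data Alternating : List ℤ → Set where
  single : Alternating (+ 1 ∷ [])
  step   : ∀ {xs} → Alternating xs → Alternating (+ 1 ∷ -[1+ 0 ] ∷ xs)

row : ∀ {n} → Matrix n → Fin n → List ℤ
row {n} B i = map (λ j → B i j) (allFin n)

col : ∀ {n} → Matrix n → Fin n → List ℤ
col {n} B j = map (λ i → B i j) (allFin n)

data Sign : ℤ → Set where
  zero⁰ : Sign (+ 0)
  one   : Sign (+ 1)
  minus : Sign -[1+ 0 ]

record IsASM {n : ℕ} (B : Matrix n) : Set where
  field
    entries : ∀ i j → Sign (B i j)
    rows    : ∀ i → Alternating (nonzeros (row B i))
    cols    : ∀ j → Alternating (nonzeros (col B j))

data Vertex : Set where
  a₁ a₂ b₁ b₂ c₁ c₂ : Vertex

_==V_ : Vertex → Vertex → Bool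
a₁ ==V a₁ = true
a₂ ==V a₂ = true
b₁ ==V b₁ = true
b₂ ==V b₂ = true
c₁ ==V c₁ = true
c₂ ==V c₂ = true
_ ==V _ = false

isZero : ℤ → Bool
isZero (+ zero) = true
isZero _ = false

sumℤ : List ℤ → ℤ
sumℤ = foldr _+_ (+ 0)

-- r = Σ_{k ≤ j} b_{i,k},  s = Σ_{k ≤ i} b_{k,j}
rowPrefix : ∀ {n} → Matrix n → Fin n → Fin n → ℤ
rowPrefix {n} B i j = sumℤ (map (λ k → B i k) (filter (λ k → k ≤? j) (allFin n)))

colPrefix : ∀ {n} → Matrix n → Fin n → Fin n → ℤ
colPrefix {n} B i j = sumℤ (map (λ k → B k j) (filter (λ k → k ≤? i) (allFin n)))

-- the vertex type C(B)_{i,j} (for an ASM, r,s ∈ {0,1})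
C : ∀ {n} → Matrix n → Fin n → Fin n → Vertex
C B i j with B i j
... | + 1 = c₁
... | -[1+ 0 ] = c₂
... | _ with isZero (rowPrefix B i j) | isZero (colPrefix B i j)
...   | true  | true  = a₁
...   | true  | false = b₁
...   | false | true  = b₂
...   | false | false = a₂

-- 1-based integer index → 0-based Fin n, if in range {1,…,n}
index : (n : ℕ) → ℤ → Maybe (Fin n)
index n (+ suc m) with m <? n
... | yes p = just (fromℕ< p)
... | no _  = nothing
index n _ = nothing

oneBased : ∀ {n} → Fin n → ℤ
oneBased i = + suc (toℕ i)

countIf : {A : Set} → (A → Bool) → List A → ℕ
countIf p [] = 0
countIf p (x ∷ xs) = if p x then suc (countIf p xs) else countIf p xs

hasVertexAt : ∀ {n} → Matrix n → Vertex → Fin n → ℤ → Bool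
hasVertexAt {n} B v i c with index n c
... | just j  = C B i j ==V v
... | nothing = false

diagCount : ∀ {n} → Matrix n → ℤ → Vertex → ℕ
diagCount {n} B a v = countIf (λ i → hasVertexAt B v i (oneBased i + a)) (allFin n)

antiDiagCount : ∀ {n} → Matrix n → ℤ → Vertex → ℕ
antiDiagCount {n} B a v = countIf (λ i → hasVertexAt B v i (a + - oneBased i)) (allFin n)

-- With ℓ and t the sums of the entries of B strictly left of and strictly above (i, j) (each 0 or 1,
-- since nonzero entries alternate starting with 1), a case check gives
--   [a₁] − [a₂] = 1 − t − ℓ − b_ij   and   [b₁] − [b₂] = t − ℓ   at (i, j).
-- In terms of the rectangle sums S(p, q) = Σ_{k<p, l<q} b_kl these read 1 − (S(i+1, j+1) − S(i, j)) and
-- S(i, j+1) − S(i+1, j), so the counts telescope along diagonals and antidiagonals.  The boundary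
-- terms cancel because every row and column of an ASM sums to 1, i.e. S(p, n) = p and S(n, q) = q.
module Submission where

open import Defs
open import Data.Nat using (ℕ)
open import Data.Integer using (ℤ)
open import Data.Product using (_×_)
open import Relation.Binary.PropositionalEquality using (_≡_)

open import Data.Bool using (Bool; true; false; if_then_else_)
open import Data.Fin as Fin using (Fin; toℕ; fromℕ<)
import Data.Fin.Properties as Fin
open import Data.Integer as ℤ using (+_; -[1+_]; _+_; _-_; -_; _⊖_)
import Data.Integer.Properties as ℤ
open import Data.Integer.Tactic.RingSolver using (solve-∀)
open import Data.List using ([]; _∷_; map; filter; tabulate; allFin)
open import Data.List.Properties using (map-tabulate)
open import Data.Nat as ℕ using (zero; suc; _≤ᵇ_; _<ᵇ_; _⊓_; _∸_)
import Data.Nat.Properties as ℕ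
open import Data.Product using (_,_)
open import Function using (_∘_)
open import Relation.Nullary using (Dec; does; yes; no)
open import Relation.Unary using (Decidable)
open import Relation.Binary.PropositionalEquality
  using (refl; sym; trans; cong; cong₂; subst; module ≡-Reasoning)

sumBelow : ℕ → (ℕ → ℤ) → ℤ
sumBelow zero    f = + 0
sumBelow (suc n) f = f 0 + sumBelow n (f ∘ suc)

sumBelow-cong : ∀ n {f g : ℕ → ℤ} → (∀ k → f k ≡ g k) → sumBelow n f ≡ sumBelow n g
sumBelow-cong zero    f≗g = refl
sumBelow-cong (suc n) f≗g = cong₂ _+_ (f≗g 0) (sumBelow-cong n (f≗g ∘ suc))

sumBelow-zero : ∀ n {f : ℕ → ℤ} → (∀ k → f k ≡ + 0) → sumBelow n f ≡ + 0
sumBelow-zero zero    f≗0 = refl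
sumBelow-zero (suc n) f≗0 = cong₂ _+_ (f≗0 0) (sumBelow-zero n (f≗0 ∘ suc))

sumBelow-suc : ∀ n (f : ℕ → ℤ) → sumBelow (suc n) f ≡ sumBelow n f + f n
sumBelow-suc zero    f = ℤ.+-comm (f 0) (+ 0)
sumBelow-suc (suc n) f = begin
  f 0 + sumBelow (suc n) (f ∘ suc)       ≡⟨ cong (_+_ (f 0)) (sumBelow-suc n (f ∘ suc)) ⟩
  f 0 + (sumBelow n (f ∘ suc) + f (suc n)) ≡⟨ ℤ.+-assoc (f 0) _ _ ⟨
  sumBelow (suc n) f + f (suc n)         ∎
  where open ≡-Reasoning

sumBelow-+ : ∀ n (f g : ℕ → ℤ) → sumBelow n (λ k → f k + g k) ≡ sumBelow n f + sumBelow n g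
sumBelow-+ zero    f g = refl
sumBelow-+ (suc n) f g =
  trans (cong (_+_ (f 0 + g 0)) (sumBelow-+ n (f ∘ suc) (g ∘ suc))) (interchange (f 0) (g 0) _ _)
  where
  interchange : ∀ a b c d → (a + b) + (c + d) ≡ (a + c) + (b + d)
  interchange = solve-∀

extend : (n : ℕ) → (Fin n → ℤ) → ℕ → ℤ
extend zero    h l       = + 0
extend (suc n) h zero    = h Fin.zero
extend (suc n) h (suc l) = extend n (h ∘ Fin.suc) l

extend-toℕ : ∀ n (h : Fin n → ℤ) i → extend n h (toℕ i) ≡ h i
extend-toℕ (suc n) h Fin.zero    = refl
extend-toℕ (suc n) h (Fin.suc i) = extend-toℕ n (h ∘ Fin.suc) i

extend-≥ : ∀ n (h : Fin n → ℤ) {l} → n ℕ.≤ l → extend n h l ≡ + 0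
extend-≥ zero    h _           = refl
extend-≥ (suc n) h (ℕ.s≤s n≤l) = extend-≥ n (h ∘ Fin.suc) n≤l

extend-zero : ∀ n {h : Fin n → ℤ} → (∀ i → h i ≡ + 0) → ∀ l → extend n h l ≡ + 0
extend-zero zero    h≗0 l       = refl
extend-zero (suc n) h≗0 zero    = h≗0 Fin.zero
extend-zero (suc n) h≗0 (suc l) = extend-zero n (h≗0 ∘ Fin.suc) l

extend-cong : ∀ n {h g : Fin n → ℤ} → (∀ i → h i ≡ g i) → ∀ l → extend n h l ≡ extend n g l
extend-cong zero    h≗g l       = refl
extend-cong (suc n) h≗g zero    = h≗g Fin.zero
extend-cong (suc n) h≗g (suc l) = extend-cong n (h≗g ∘ Fin.suc) l

sumℤ-tabulate : ∀ n (h : Fin n → ℤ) → sumℤ (tabulate h) ≡ sumBelow n (extend n h)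
sumℤ-tabulate zero    h = refl
sumℤ-tabulate (suc n) h = cong (_+_ (h Fin.zero)) (sumℤ-tabulate n (h ∘ Fin.suc))

sumℤ-filter : ∀ {A : Set} {P : A → Set} (P? : Decidable P) (f : A → ℤ) xs →
  sumℤ (map f (filter P? xs)) ≡ sumℤ (map (λ x → if does (P? x) then f x else + 0) xs)
sumℤ-filter P? f [] = refl
sumℤ-filter P? f (x ∷ xs) with does (P? x)
... | true  = cong (_+_ (f x)) (sumℤ-filter P? f xs)
... | false = trans (sumℤ-filter P? f xs) (sym (ℤ.+-identityˡ _))

sumBelow-masked-<ᵇ : ∀ n (h : Fin n → ℤ) q →
  sumBelow n (extend n (λ k → if toℕ k <ᵇ q then h k else + 0)) ≡ sumBelow q (extend n h)
sumBelow-masked-<ᵇ zero    h q       = sym (sumBelow-zero q (λ _ → refl))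
sumBelow-masked-<ᵇ (suc n) h zero    = trans (ℤ.+-identityˡ _) (sumBelow-zero n (extend-zero n (λ _ → refl)))
sumBelow-masked-<ᵇ (suc n) h (suc q) = cong (_+_ (h Fin.zero)) (sumBelow-masked-<ᵇ n (h ∘ Fin.suc) q)

sumBelow-masked-≤ᵇ : ∀ n (h : Fin n → ℤ) d →
  sumBelow n (extend n (λ k → if toℕ k ≤ᵇ d then h k else + 0)) ≡ sumBelow (suc d) (extend n h)
sumBelow-masked-≤ᵇ zero    h d = sym (sumBelow-zero (suc d) (λ _ → refl))
sumBelow-masked-≤ᵇ (suc n) h d = cong (_+_ (h Fin.zero)) (sumBelow-masked-<ᵇ n (h ∘ Fin.suc) d)

sumℤ-filter-≤ : ∀ n (h : Fin n → ℤ) (j : Fin n) →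
  sumℤ (map h (filter (λ k → k Fin.≤? j) (allFin n))) ≡ sumBelow (suc (toℕ j)) (extend n h)
sumℤ-filter-≤ n h j = begin
  sumℤ (map h (filter (λ k → k Fin.≤? j) (allFin n))) ≡⟨ sumℤ-filter (λ k → k Fin.≤? j) h (allFin n) ⟩
  sumℤ (map H (allFin n))                             ≡⟨ cong sumℤ (map-tabulate (λ k → k) H) ⟩
  sumℤ (tabulate H)                                   ≡⟨ sumℤ-tabulate n H ⟩
  sumBelow n (extend n H)                             ≡⟨ sumBelow-masked-≤ᵇ n h (toℕ j) ⟩
  sumBelow (suc (toℕ j)) (extend n h)                 ∎
  where
  open ≡-Reasoning
  -- does (k Fin.≤? j) computes to toℕ k ≤ᵇ toℕ j
  H : Fin n → ℤ
  H k = if does (k Fin.≤? j) then h k else + 0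

data Bit : ℤ → Set where
  bit0 : Bit (+ 0)
  bit1 : Bit (+ 1)

-- The carry c is the sum of the entries read so far; Alternating (nonzeros (c ∷ rest)) says that the
-- nonzero entries of rest continue the alternation.
carry-step : ∀ {c x xs} → Bit c → Sign x → Alternating (nonzeros (c ∷ x ∷ xs)) →
  Bit (c + x) × Alternating (nonzeros (c + x ∷ xs))
carry-step bit0 zero⁰ alt        = bit0 , alt
carry-step bit0 one   alt        = bit1 , alt
carry-step bit0 minus ()
carry-step bit1 zero⁰ alt        = bit1 , alt
carry-step bit1 one   ()
carry-step bit1 minus (step alt) = bit0 , alt

alternating-prefixSum-bit : ∀ n (h : Fin n → ℤ) → (∀ k → Sign (h k)) → ∀ {c} → Bit c →
  Alternating (nonzeros (c ∷ tabulate h)) → ∀ q → Bit (c + sumBelow q (extend n h))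
alternating-prefixSum-bit zero    h sign {c} b alt q =
  subst Bit (trans (sym (ℤ.+-identityʳ c)) (cong (_+_ c) (sym (sumBelow-zero q (λ _ → refl))))) b
alternating-prefixSum-bit (suc n) h sign {c} b alt zero    = subst Bit (sym (ℤ.+-identityʳ c)) b
alternating-prefixSum-bit (suc n) h sign {c} b alt (suc q) with carry-step b (sign Fin.zero) alt
... | b′ , alt′ = subst Bit (ℤ.+-assoc c (h Fin.zero) _)
  (alternating-prefixSum-bit n (h ∘ Fin.suc) (sign ∘ Fin.suc) b′ alt′ q)

alternating-sum≡1 : ∀ n (h : Fin n → ℤ) → (∀ k → Sign (h k)) → ∀ {c} → Bit c →
  Alternating (nonzeros (c ∷ tabulate h)) → ∀ q → n ℕ.≤ q → c + sumBelow q (extend n h) ≡ + 1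
alternating-sum≡1 zero    h sign bit1 alt q _ = cong (_+_ (+ 1)) (sumBelow-zero q (λ _ → refl))
alternating-sum≡1 (suc n) h sign {c} b alt (suc q) (ℕ.s≤s n≤q) with carry-step b (sign Fin.zero) alt
... | b′ , alt′ = trans (sym (ℤ.+-assoc c (h Fin.zero) _))
  (alternating-sum≡1 n (h ∘ Fin.suc) (sign ∘ Fin.suc) b′ alt′ q n≤q)

module RectangleSums (E : ℕ → ℕ → ℤ) where

  rowSum : ℕ → ℕ → ℤ
  rowSum k q = sumBelow q (E k)

  colSum : ℕ → ℕ → ℤ
  colSum p l = sumBelow p (λ k → E k l)

  rectSum : ℕ → ℕ → ℤ
  rectSum p q = sumBelow p (λ k → rowSum k q)

  rectSum-zeroʳ : ∀ p → rectSum p 0 ≡ + 0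
  rectSum-zeroʳ p = sumBelow-zero p (λ _ → refl)

  rectSum-sucˡ : ∀ p q → rectSum (suc p) q ≡ rectSum p q + rowSum p q
  rectSum-sucˡ p q = sumBelow-suc p (λ k → rowSum k q)

  rectSum-sucʳ : ∀ p q → rectSum p (suc q) ≡ rectSum p q + colSum p q
  rectSum-sucʳ p q =
    trans (sumBelow-cong p (λ k → sumBelow-suc q (E k))) (sumBelow-+ p (λ k → rowSum k q) (λ k → E k q))

  rectSum-diagonal : ∀ p q → rectSum (suc p) (suc q) - rectSum p q ≡ colSum p q + rowSum p (suc q)
  rectSum-diagonal p q = begin
    rectSum (suc p) (suc q) - rectSum p q
      ≡⟨ cong (_- rectSum p q) (rectSum-sucˡ p (suc q)) ⟩
    rectSum p (suc q) + rowSum p (suc q) - rectSum p q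
      ≡⟨ cong (λ s → s + rowSum p (suc q) - rectSum p q) (rectSum-sucʳ p q) ⟩
    rectSum p q + colSum p q + rowSum p (suc q) - rectSum p q
      ≡⟨ cancel (rectSum p q) _ _ ⟩
    colSum p q + rowSum p (suc q) ∎
    where
    open ≡-Reasoning
    cancel : ∀ s c r → s + c + r - s ≡ c + r
    cancel = solve-∀

  rectSum-antidiagonal : ∀ p q → rectSum p (suc q) - rectSum (suc p) q ≡ colSum p q - rowSum p q
  rectSum-antidiagonal p q = begin
    rectSum p (suc q) - rectSum (suc p) q                 ≡⟨ cong₂ _-_ (rectSum-sucʳ p q) (rectSum-sucˡ p q) ⟩
    rectSum p q + colSum p q - (rectSum p q + rowSum p q) ≡⟨ cancel (rectSum p q) _ _ ⟩
    colSum p q - rowSum p q                               ∎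
    where
    open ≡-Reasoning
    cancel : ∀ s c r → s + c - (s + r) ≡ c - r
    cancel = solve-∀

  diagonalPotential : ℕ → ℕ → ℤ
  diagonalPotential p q = + q - rectSum p q

  diagonalPotential-zeroʳ : ∀ p → diagonalPotential p 0 ≡ + 0
  diagonalPotential-zeroʳ p = cong (λ s → + 0 - s) (rectSum-zeroʳ p)

  diagonalPotential-step : ∀ p q →
    diagonalPotential (suc p) (suc q) - diagonalPotential p q ≡ + 1 - (colSum p q + rowSum p (suc q))
  diagonalPotential-step p q = begin
    (+ 1 + + q - rectSum (suc p) (suc q)) - (+ q - rectSum p q)
      ≡⟨ rearrange (+ q) (rectSum (suc p) (suc q)) (rectSum p q) ⟩
    + 1 - (rectSum (suc p) (suc q) - rectSum p q)
      ≡⟨ cong (λ s → + 1 - s) (rectSum-diagonal p q) ⟩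
    + 1 - (colSum p q + rowSum p (suc q)) ∎
    where
    open ≡-Reasoning
    rearrange : ∀ q s s′ → (+ 1 + q - s) - (q - s′) ≡ + 1 - (s - s′)
    rearrange = solve-∀

χ : Bool → ℤ
χ true  = + 1
χ false = + 0

balance : Vertex → Vertex → Vertex → ℤ
balance v w u = χ (u ==V v) - χ (u ==V w)

vertex : ℤ → ℤ → ℤ → Vertex
vertex (+ 1)      r s = c₁
vertex -[1+ 0 ]   r s = c₂
vertex _          r s with isZero r | isZero s
... | true  | true  = a₁
... | true  | false = b₁
... | false | true  = b₂
... | false | false = a₂

C≡vertex : ∀ {n} (B : Matrix n) → (∀ i j → Sign (B i j)) →
  ∀ i j → C B i j ≡ vertex (B i j) (rowPrefix B i j) (colPrefix B i j)
C≡vertex B sign i j with B i j | sign i j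
... | _ | one   = refl
... | _ | minus = refl
... | _ | zero⁰ with isZero (rowPrefix B i j) | isZero (colPrefix B i j)
...   | true  | true  = refl
...   | true  | false = refl
...   | false | true  = refl
...   | false | false = refl

balance-a-vertex : ∀ {x ℓ t} → Sign x → Bit ℓ → Bit t → Bit (ℓ + x) → Bit (t + x) →
  balance a₁ a₂ (vertex x (ℓ + x) (t + x)) ≡ + 1 - (t + (ℓ + x))
balance-a-vertex zero⁰ bit0 bit0 _ _ = refl
balance-a-vertex zero⁰ bit0 bit1 _ _ = refl
balance-a-vertex zero⁰ bit1 bit0 _ _ = refl
balance-a-vertex zero⁰ bit1 bit1 _ _ = refl
balance-a-vertex one   bit0 bit0 _ _ = refl
balance-a-vertex minus bit1 bit1 _ _ = refl

balance-b-vertex : ∀ {x ℓ t} → Sign x → Bit ℓ → Bit t → Bit (ℓ + x) → Bit (t + x) →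
  balance b₁ b₂ (vertex x (ℓ + x) (t + x)) ≡ t - ℓ
balance-b-vertex zero⁰ bit0 bit0 _ _ = refl
balance-b-vertex zero⁰ bit0 bit1 _ _ = refl
balance-b-vertex zero⁰ bit1 bit0 _ _ = refl
balance-b-vertex zero⁰ bit1 bit1 _ _ = refl
balance-b-vertex one   bit0 bit0 _ _ = refl
balance-b-vertex minus bit1 bit1 _ _ = refl

telescope : ∀ {n} (f : Fin n → ℤ) (F : ℕ → ℤ) → (∀ i → f i ≡ F (suc (toℕ i)) - F (toℕ i)) →
  sumℤ (tabulate f) ≡ F n - F 0
telescope {zero}  f F f≡ΔF = sym (ℤ.+-inverseʳ (F 0))
telescope {suc n} f F f≡ΔF =
  trans (cong₂ _+_ (f≡ΔF Fin.zero) (telescope (f ∘ Fin.suc) (F ∘ suc) (f≡ΔF ∘ Fin.suc)))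
        (collapse (F 0) (F 1) (F (suc n)))
  where
  collapse : ∀ a b c → (b - a) + (c - b) ≡ c - a
  collapse = solve-∀

countIf-∷ : ∀ {A : Set} (p : A → Bool) x xs → + countIf p (x ∷ xs) ≡ χ (p x) + + countIf p xs
countIf-∷ p x xs with p x
... | true  = refl
... | false = refl

countIf-difference : ∀ {A : Set} (p q : A → Bool) xs →
  + countIf p xs - + countIf q xs ≡ sumℤ (map (λ x → χ (p x) - χ (q x)) xs)
countIf-difference p q []       = refl
countIf-difference p q (x ∷ xs) =
  trans (cong₂ _-_ (countIf-∷ p x xs) (countIf-∷ q x xs))
        (trans (interchange (χ (p x)) (χ (q x)) _ _)
               (cong (_+_ (χ (p x) - χ (q x))) (countIf-difference p q xs)))
  where
  interchange : ∀ u v P Q → (u + P) - (v + Q) ≡ (u - v) + (P - Q)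
  interchange = solve-∀

countIf-≡-telescoping : ∀ n (p q : Fin n → Bool) (F : ℕ → ℤ) →
  (∀ i → χ (p i) - χ (q i) ≡ F (suc (toℕ i)) - F (toℕ i)) → F n ≡ F 0 →
  countIf p (allFin n) ≡ countIf q (allFin n)
countIf-≡-telescoping n p q F f≡ΔF Fn≡F0 = ℤ.+-injective (ℤ.i-j≡0⇒i≡j _ _ (begin
  + countIf p (allFin n) - + countIf q (allFin n) ≡⟨ countIf-difference p q (allFin n) ⟩
  sumℤ (map g (allFin n))                         ≡⟨ cong sumℤ (map-tabulate (λ i → i) g) ⟩
  sumℤ (tabulate g)                               ≡⟨ telescope g F f≡ΔF ⟩
  F n - F 0                                       ≡⟨ cong (_- F 0) Fn≡F0 ⟩
  F 0 - F 0                                       ≡⟨ ℤ.+-inverseʳ (F 0) ⟩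
  + 0                                             ∎))
  where
  open ≡-Reasoning
  g : Fin n → ℤ
  g i = χ (p i) - χ (q i)

positivePart : ℤ → ℕ
positivePart (+ j)      = j
positivePart -[1+ _ ] = 0

positivePart-⊖ : ∀ j m → positivePart (j ⊖ m) ≡ j ∸ m
positivePart-⊖ zero    zero    = refl
positivePart-⊖ zero    (suc m) = refl
positivePart-⊖ (suc j) zero    = refl
positivePart-⊖ (suc j) (suc m) = trans (cong positivePart (ℤ.[1+m]⊖[1+n]≡m⊖n j m)) (positivePart-⊖ j m)

positivePart-minus : ∀ x m → positivePart (x - + m) ≡ positivePart x ∸ m
positivePart-minus (+ j)    m       = trans (cong positivePart (ℤ.m-n≡m⊖n j m)) (positivePart-⊖ j m)
positivePart-minus -[1+ k ] zero    = refl
positivePart-minus -[1+ k ] (suc m) = refl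

module ASM {n} (B : Matrix n) (asm : IsASM B) where
  open IsASM asm

  E : ℕ → ℕ → ℤ
  E k l = extend n (λ i → extend n (B i) l) k

  open RectangleSums E public

  rowSum-toℕ : ∀ i q → rowSum (toℕ i) q ≡ sumBelow q (extend n (B i))
  rowSum-toℕ i q = sumBelow-cong q (λ l → extend-toℕ n (λ i′ → extend n (B i′) l) i)

  colSum-toℕ : ∀ p j → colSum p (toℕ j) ≡ sumBelow p (extend n (λ k → B k j))
  colSum-toℕ p j = sumBelow-cong p (extend-cong n (λ i → extend-toℕ n (B i) j))

  E-toℕ : ∀ i j → E (toℕ i) (toℕ j) ≡ B i j
  E-toℕ i j = trans (extend-toℕ n (λ i′ → extend n (B i′) (toℕ j)) i) (extend-toℕ n (B i) j)

  rowAlternating : ∀ i → Alternating (nonzeros (tabulate (B i)))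
  rowAlternating i = subst (Alternating ∘ nonzeros) (map-tabulate (λ k → k) (B i)) (rows i)

  colAlternating : ∀ j → Alternating (nonzeros (tabulate (λ k → B k j)))
  colAlternating j = subst (Alternating ∘ nonzeros) (map-tabulate (λ k → k) (λ k → B k j)) (cols j)

  rowSum-bit : ∀ i q → Bit (rowSum (toℕ i) q)
  rowSum-bit i q = subst Bit (trans (ℤ.+-identityˡ _) (sym (rowSum-toℕ i q)))
    (alternating-prefixSum-bit n (B i) (entries i) bit0 (rowAlternating i) q)

  colSum-bit : ∀ p j → Bit (colSum p (toℕ j))
  colSum-bit p j = subst Bit (trans (ℤ.+-identityˡ _) (sym (colSum-toℕ p j)))
    (alternating-prefixSum-bit n (λ k → B k j) (λ k → entries k j) bit0 (colAlternating j) p)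

  rowSum-full : ∀ i {q} → n ℕ.≤ q → rowSum (toℕ i) q ≡ + 1
  rowSum-full i {q} n≤q = trans (rowSum-toℕ i q) (trans (sym (ℤ.+-identityˡ _))
    (alternating-sum≡1 n (B i) (entries i) bit0 (rowAlternating i) q n≤q))

  colSum-full : ∀ {l} → l ℕ.< n → colSum n l ≡ + 1
  colSum-full {l} l<n = subst (λ l → colSum n l ≡ + 1) (Fin.toℕ-fromℕ< l<n)
    (trans (colSum-toℕ n j) (trans (sym (ℤ.+-identityˡ _))
      (alternating-sum≡1 n (λ k → B k j) (λ k → entries k j) bit0 (colAlternating j) n ℕ.≤-refl)))
    where
    j = fromℕ< l<n

  colSum-beyond : ∀ p {l} → n ℕ.≤ l → colSum p l ≡ + 0
  colSum-beyond p n≤l = sumBelow-zero p (extend-zero n (λ i → extend-≥ n (B i) n≤l))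

  rowSum-suc : ∀ i j → rowSum (toℕ i) (suc (toℕ j)) ≡ rowSum (toℕ i) (toℕ j) + B i j
  rowSum-suc i j =
    trans (sumBelow-suc (toℕ j) (E (toℕ i))) (cong (_+_ (rowSum (toℕ i) (toℕ j))) (E-toℕ i j))

  colSum-suc : ∀ i j → colSum (suc (toℕ i)) (toℕ j) ≡ colSum (toℕ i) (toℕ j) + B i j
  colSum-suc i j =
    trans (sumBelow-suc (toℕ i) (λ k → E k (toℕ j))) (cong (_+_ (colSum (toℕ i) (toℕ j))) (E-toℕ i j))

  rowSum-suc-bit : ∀ i j → Bit (rowSum (toℕ i) (toℕ j) + B i j)
  rowSum-suc-bit i j = subst Bit (rowSum-suc i j) (rowSum-bit i (suc (toℕ j)))

  colSum-suc-bit : ∀ i j → Bit (colSum (toℕ i) (toℕ j) + B i j)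
  colSum-suc-bit i j = subst Bit (colSum-suc i j) (colSum-bit (suc (toℕ i)) j)

  C≡vertex-sums : ∀ i j → let ℓ = rowSum (toℕ i) (toℕ j); t = colSum (toℕ i) (toℕ j) in
    C B i j ≡ vertex (B i j) (ℓ + B i j) (t + B i j)
  C≡vertex-sums i j = trans (C≡vertex B entries i j) (cong₂ (vertex (B i j))
    (trans (sumℤ-filter-≤ n (B i) j) (trans (sym (rowSum-toℕ i (suc (toℕ j)))) (rowSum-suc i j)))
    (trans (sumℤ-filter-≤ n (λ k → B k j) i) (trans (sym (colSum-toℕ (suc (toℕ i)) j)) (colSum-suc i j))))

  balance-a-cell : ∀ i j →
    balance a₁ a₂ (C B i j) ≡ + 1 - (colSum (toℕ i) (toℕ j) + rowSum (toℕ i) (suc (toℕ j)))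
  balance-a-cell i j = begin
    balance a₁ a₂ (C B i j)                          ≡⟨ cong (balance a₁ a₂) (C≡vertex-sums i j) ⟩
    balance a₁ a₂ (vertex (B i j) (ℓ + B i j) (t + B i j)) ≡⟨ balance-a-vertex (entries i j)
         (rowSum-bit i (toℕ j)) (colSum-bit (toℕ i) j) (rowSum-suc-bit i j) (colSum-suc-bit i j) ⟩
    + 1 - (t + (ℓ + B i j))                          ≡⟨ cong (λ r → + 1 - (t + r)) (rowSum-suc i j) ⟨
    + 1 - (t + rowSum (toℕ i) (suc (toℕ j)))         ∎
    where
    open ≡-Reasoning
    ℓ = rowSum (toℕ i) (toℕ j)
    t = colSum (toℕ i) (toℕ j)

  balance-b-cell : ∀ i j → balance b₁ b₂ (C B i j) ≡ colSum (toℕ i) (toℕ j) - rowSum (toℕ i) (toℕ j)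
  balance-b-cell i j = trans (cong (balance b₁ b₂) (C≡vertex-sums i j)) (balance-b-vertex (entries i j)
    (rowSum-bit i (toℕ j)) (colSum-bit (toℕ i) j) (rowSum-suc-bit i j) (colSum-suc-bit i j))

  rectSum-fullHeight : ∀ q → rectSum n q ≡ + (n ⊓ q)
  rectSum-fullHeight zero    = trans (rectSum-zeroʳ n) (cong +_ (sym (ℕ.⊓-zeroʳ n)))
  rectSum-fullHeight (suc q) = trans (rectSum-sucʳ n q) (byCase (q ℕ.<? n))
    where
    byCase : Dec (q ℕ.< n) → rectSum n q + colSum n q ≡ + (n ⊓ suc q)
    byCase (yes q<n) = begin
      rectSum n q + colSum n q ≡⟨ cong₂ _+_ (rectSum-fullHeight q) (colSum-full q<n) ⟩
      + (n ⊓ q ℕ.+ 1)          ≡⟨ cong +_ (cong (ℕ._+ 1) (ℕ.m≥n⇒m⊓n≡n (ℕ.<⇒≤ q<n))) ⟩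
      + (q ℕ.+ 1)              ≡⟨ cong +_ (ℕ.+-comm q 1) ⟩
      + suc q                  ≡⟨ cong +_ (ℕ.m≥n⇒m⊓n≡n q<n) ⟨
      + (n ⊓ suc q)            ∎
      where open ≡-Reasoning
    byCase (no q≮n) = begin
      rectSum n q + colSum n q ≡⟨ cong₂ _+_ (rectSum-fullHeight q) (colSum-beyond n (ℕ.≮⇒≥ q≮n)) ⟩
      + (n ⊓ q ℕ.+ 0)          ≡⟨ cong +_ (ℕ.+-identityʳ _) ⟩
      + (n ⊓ q)                ≡⟨ cong +_ (ℕ.m≤n⇒m⊓n≡m (ℕ.≮⇒≥ q≮n)) ⟩
      + n                      ≡⟨ cong +_ (ℕ.m≤n⇒m⊓n≡m (ℕ.m≤n⇒m≤1+n (ℕ.≮⇒≥ q≮n))) ⟨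
      + (n ⊓ suc q)            ∎
      where open ≡-Reasoning

  rectSum-fullHeight-∸ : ∀ q → rectSum n q + + (q ∸ n) ≡ + q
  rectSum-fullHeight-∸ q =
    trans (cong (λ s → s + + (q ∸ n)) (rectSum-fullHeight q)) (cong +_ (ℕ.m⊓n+n∸m≡n n q))

  balanceAt : Vertex → Vertex → Fin n → ℤ → ℤ
  balanceAt v w i c = χ (hasVertexAt B v i c) - χ (hasVertexAt B w i c)

  -- y is the 0-based column as an integer; columns left of the matrix have positivePart 0.
  -- Splitting on j <? n also reduces index n (+ suc j) inside hasVertexAt.
  diagonal-step : ∀ i y → balanceAt a₁ a₂ i (+ 1 + y) ≡
    diagonalPotential (suc (toℕ i)) (positivePart (+ 1 + y)) - diagonalPotential (toℕ i) (positivePart y)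
  diagonal-step i (+ j) with j ℕ.<? n
  ... | yes j<n = begin
    balance a₁ a₂ (C B i (fromℕ< j<n))                          ≡⟨ balance-a-cell i (fromℕ< j<n) ⟩
    + 1 - (colSum (toℕ i) j′ + rowSum (toℕ i) (suc j′))
      ≡⟨ cong (λ l → + 1 - (colSum (toℕ i) l + rowSum (toℕ i) (suc l))) (Fin.toℕ-fromℕ< j<n) ⟩
    + 1 - (colSum (toℕ i) j + rowSum (toℕ i) (suc j))           ≡⟨ diagonalPotential-step (toℕ i) j ⟨
    diagonalPotential (suc (toℕ i)) (suc j) - diagonalPotential (toℕ i) j ∎
    where
    open ≡-Reasoning
    j′ = toℕ (fromℕ< j<n)
  ... | no j≮n = begin
    + 0                                                         ≡⟨ cong₂ (λ c r → + 1 - (c + r))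
                                                                     (colSum-beyond (toℕ i) (ℕ.≮⇒≥ j≮n))
                                                                     (rowSum-full i (ℕ.m≤n⇒m≤1+n (ℕ.≮⇒≥ j≮n))) ⟨
    + 1 - (colSum (toℕ i) j + rowSum (toℕ i) (suc j))           ≡⟨ diagonalPotential-step (toℕ i) j ⟨
    diagonalPotential (suc (toℕ i)) (suc j) - diagonalPotential (toℕ i) j ∎
    where open ≡-Reasoning
  diagonal-step i -[1+ zero ]  =
    sym (cong₂ _-_ (diagonalPotential-zeroʳ (suc (toℕ i))) (diagonalPotential-zeroʳ (toℕ i)))
  diagonal-step i -[1+ suc m ] =
    sym (cong₂ _-_ (diagonalPotential-zeroʳ (suc (toℕ i))) (diagonalPotential-zeroʳ (toℕ i)))

  antidiagonalPotential : ℕ → ℕ → ℤ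
  antidiagonalPotential p q = - (rectSum p q + + (q ∸ n))

  antidiagonalPotential-zeroʳ : ∀ p → antidiagonalPotential p 0 ≡ + 0
  antidiagonalPotential-zeroʳ p = cong₂ (λ s d → - (s + + d)) (rectSum-zeroʳ p) (ℕ.0∸n≡0 n)

  -- Right of the matrix colSum − rowSum is 0 − 1 although no vertex is counted there;
  -- the term q ∸ n of antidiagonalPotential absorbs this.
  overhang : ℕ → ℤ
  overhang q = + (suc q ∸ n) - + (q ∸ n)

  overhang-< : ∀ {q} → q ℕ.< n → overhang q ≡ + 0
  overhang-< q<n = cong₂ (λ d′ d → + d′ - + d) (ℕ.m≤n⇒m∸n≡0 q<n) (ℕ.m≤n⇒m∸n≡0 (ℕ.<⇒≤ q<n))

  overhang-≥ : ∀ {q} → n ℕ.≤ q → overhang q ≡ + 1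
  overhang-≥ {q} n≤q = trans (cong (λ d′ → + d′ - + (q ∸ n)) (ℕ.+-∸-assoc 1 n≤q)) (cancel (+ (q ∸ n)))
    where
    cancel : ∀ d → (+ 1 + d) - d ≡ + 1
    cancel = solve-∀

  antidiagonalPotential-step : ∀ p q →
    antidiagonalPotential (suc p) q - antidiagonalPotential p (suc q) ≡ (colSum p q - rowSum p q) + overhang q
  antidiagonalPotential-step p q =
    trans (rearrange (rectSum (suc p) q) (rectSum p (suc q)) _ _)
          (cong (λ s → s + overhang q) (rectSum-antidiagonal p q))
    where
    rearrange : ∀ s s′ d d′ → - (s + d) - - (s′ + d′) ≡ (s′ - s) + (d′ - d)
    rearrange = solve-∀

  antidiagonal-step : ∀ i y → balanceAt b₁ b₂ i (+ 1 + y) ≡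
    antidiagonalPotential (suc (toℕ i)) (positivePart y) - antidiagonalPotential (toℕ i) (positivePart (+ 1 + y))
  antidiagonal-step i (+ j) with j ℕ.<? n
  ... | yes j<n = begin
    balance b₁ b₂ (C B i (fromℕ< j<n))                    ≡⟨ balance-b-cell i (fromℕ< j<n) ⟩
    colSum (toℕ i) j′ - rowSum (toℕ i) j′
      ≡⟨ cong (λ l → colSum (toℕ i) l - rowSum (toℕ i) l) (Fin.toℕ-fromℕ< j<n) ⟩
    colSum (toℕ i) j - rowSum (toℕ i) j                   ≡⟨ ℤ.+-identityʳ _ ⟨
    (colSum (toℕ i) j - rowSum (toℕ i) j) + + 0
      ≡⟨ cong (_+_ (colSum (toℕ i) j - rowSum (toℕ i) j)) (overhang-< j<n) ⟨
    (colSum (toℕ i) j - rowSum (toℕ i) j) + overhang j    ≡⟨ antidiagonalPotential-step (toℕ i) j ⟨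
    antidiagonalPotential (suc (toℕ i)) j - antidiagonalPotential (toℕ i) (suc j) ∎
    where
    open ≡-Reasoning
    j′ = toℕ (fromℕ< j<n)
  ... | no j≮n = begin
    + 0                                                   ≡⟨ cong (_+_ (+ 0 - + 1)) (overhang-≥ n≤j) ⟨
    (+ 0 - + 1) + overhang j                              ≡⟨ cong₂ (λ c r → (c - r) + overhang j)
                                                               (colSum-beyond (toℕ i) n≤j) (rowSum-full i n≤j) ⟨
    (colSum (toℕ i) j - rowSum (toℕ i) j) + overhang j    ≡⟨ antidiagonalPotential-step (toℕ i) j ⟨
    antidiagonalPotential (suc (toℕ i)) j - antidiagonalPotential (toℕ i) (suc j) ∎
    where
    open ≡-Reasoning
    n≤j = ℕ.≮⇒≥ j≮n
  antidiagonal-step i -[1+ zero ]  =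
    sym (cong₂ _-_ (antidiagonalPotential-zeroʳ (suc (toℕ i))) (antidiagonalPotential-zeroʳ (toℕ i)))
  antidiagonal-step i -[1+ suc m ] =
    sym (cong₂ _-_ (antidiagonalPotential-zeroʳ (suc (toℕ i))) (antidiagonalPotential-zeroʳ (toℕ i)))

  diagonalPotential-fullHeight : ∀ q → diagonalPotential n q ≡ + (q ∸ n)
  diagonalPotential-fullHeight q =
    trans (cong (λ t → t - rectSum n q) (sym (rectSum-fullHeight-∸ q))) (cancel (rectSum n q) _)
    where
    cancel : ∀ s d → (s + d) - s ≡ d
    cancel = solve-∀

  diagonal-balanced : ∀ a → diagCount B a a₁ ≡ diagCount B a a₂
  diagonal-balanced a = countIf-≡-telescoping n _ _ F row-step boundary
    where
    F : ℕ → ℤ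
    F p = diagonalPotential p (positivePart (+ p + a))
    shift : ∀ i → + suc (toℕ i) + a ≡ + 1 + (+ toℕ i + a)
    shift i = ℤ.+-assoc (+ 1) (+ toℕ i) a
    row-step : ∀ i → balanceAt a₁ a₂ i (oneBased i + a) ≡ F (suc (toℕ i)) - F (toℕ i)
    row-step i = trans (cong (balanceAt a₁ a₂ i) (shift i)) (trans (diagonal-step i (+ toℕ i + a))
      (cong (λ c → diagonalPotential (suc (toℕ i)) (positivePart c) - F (toℕ i)) (sym (shift i))))
    boundary : F n ≡ F 0
    boundary = begin
      F n                                     ≡⟨ diagonalPotential-fullHeight _ ⟩
      + (positivePart (+ n + a) ∸ n)          ≡⟨ cong +_ (positivePart-minus (+ n + a) n) ⟨
      + positivePart (+ n + a - + n)          ≡⟨ cong (+_ ∘ positivePart) (cancel (+ n) a) ⟩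
      + positivePart a                        ≡⟨ cong (+_ ∘ positivePart) (ℤ.+-identityˡ a) ⟨
      + positivePart (+ 0 + a)                ≡⟨ ℤ.+-identityʳ _ ⟨
      F 0                                     ∎
      where
      open ≡-Reasoning
      cancel : ∀ m x → m + x - m ≡ x
      cancel = solve-∀

  antidiagonal-balanced : ∀ a → antiDiagCount B a b₁ ≡ antiDiagCount B a b₂
  antidiagonal-balanced a = countIf-≡-telescoping n _ _ F row-step boundary
    where
    F : ℕ → ℤ
    F p = antidiagonalPotential p (positivePart (a - + suc p))
    shift : ∀ i → a - + suc (toℕ i) ≡ + 1 + (a - + suc (suc (toℕ i)))
    shift i = rearrange a (+ toℕ i)
      where
      rearrange : ∀ a t → a - (+ 1 + t) ≡ + 1 + (a - (+ 1 + (+ 1 + t)))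
      rearrange = solve-∀
    row-step : ∀ i → balanceAt b₁ b₂ i (a + - oneBased i) ≡ F (suc (toℕ i)) - F (toℕ i)
    row-step i = trans (cong (balanceAt b₁ b₂ i) (shift i))
      (trans (antidiagonal-step i (a - + suc (suc (toℕ i))))
        (cong (λ c → F (suc (toℕ i)) - antidiagonalPotential (toℕ i) (positivePart c)) (sym (shift i))))
    boundary : F n ≡ F 0
    boundary = begin
      F n                                     ≡⟨ cong -_ (rectSum-fullHeight-∸ _) ⟩
      - + positivePart (a - + suc n)          ≡⟨ cong (-_ ∘ +_ ∘ positivePart) (split a (+ n)) ⟩
      - + positivePart (a - + 1 - + n)        ≡⟨ cong (-_ ∘ +_) (positivePart-minus (a - + 1) n) ⟩
      F 0                                     ∎
      where
      open ≡-Reasoning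
      split : ∀ a m → a - (+ 1 + m) ≡ a - + 1 - m
      split = solve-∀

lemma6p2 : (n : ℕ) (B : Matrix n) → IsASM B → (a : ℤ) →
    (diagCount B a a₁ ≡ diagCount B a a₂) × (antiDiagCount B a b₁ ≡ antiDiagCount B a b₂)
lemma6p2 n B asm a = diagonal-balanced a , antidiagonal-balanced a
  where open ASM B asm
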